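{- Let $\mathfrak{M}=(T,<,I,V)$ and $\mathfrak{M}'=(T',<',I',V')$ be models, $(t,\pi)$ a couple of $\mathfrak{M}$ and $(t',\pi')$ a couple of $\mathfrak{M}'$, and suppose there is a bisimulation (in the sense for the language with $F$) between $(\mathfrak{M},(t,\pi))$ and $(\mathfrak{M}',(t',\pi'))$. Then for every formula $\varphi$ built from propositional variables with $\neg,\wedge,G,H,L,F$, $\mathfrak{M},(t,\pi)\models\varphi$ iff $\mathfrak{M}',(t',\pi')\models\varphi$.
   Context: A tree is a pair $(T,<)$ with $<$ irreflexive, transitive and downward linear (if $b<a$ and $c<a$ then $b=c$, $b<c$ or $c<b$). A history is a $\subseteq$-maximal $<$-linear subset of $T$; $H_t$ is the set of histories containing $t$. An indistinguishability function assigns to each $t$ an equivalence relation $I_t$ on $H_t$ such that $hI_tk$ and $s<t$ imply $hI_sk$. $\Pi_t$ is the set of $I_t$-classes, $[h]_{I_s}$ the $I_s$-class of $h$. A model is $(T,<,I,V)$ with $(T,<)$ a tree, $I$ an indistinguishability function and $V$ mapping each propositional variable to a set of couples, couples being the elements of $\bigcup_{t\in T}(\{t\}\times\Pi_t)$. Satisfaction at $(t,\pi)$: $p$ iff $(t,\pi)\in V(p)$; Boolean clauses as usual; $G\varphi$ iff for each $h\in\pi$ and $s\in h$ with $t<s$, $\varphi$ holds at $(s,[h]_{I_s})$; $H\varphi$ iff for each $h\in\pi$ and $s\in h$ with $s<t$, $\varphi$ holds at $(s,[h]_{I_s})$; $L\varphi$ iff for each $\rho\in\Pi_t$, $\varphi$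 holds at $(t,\rho)$; $F\varphi$ iff for each $h\in\pi$ there is $s\in h$ with $t<s$ such that $\varphi$ holds at $(s,[h]_{I_s})$. On couples: $(t,\pi)\prec(s,\rho)$ iff $t<s$ and $\pi\supseteq\rho$; $\succ$ is the converse of $\prec$; $(t,\pi)\sim(s,\rho)$ iff $t=s$; primed versions in $\mathfrak{M}'$. A bisimulation between $(\mathfrak{M},(t,\pi))$ and $(\mathfrak{M}',(t',\pi'))$ is a relation $B$ between couples of $\mathfrak{M}$ and couples of $\mathfrak{M}'$ with $(t,\pi)B(t',\pi')$ such that whenever $(s,\rho)B(s',\rho')$: (PV) for every propositional variable $p$, $(s,\rho)\in V(p)$ iff $(s',\rho')\in V'(p)$; for each $R\in\{\prec,\succ,\sim\}$ with primed counterpart $R'$: (forth) for every couple $y$ with $(s,\rho)Ry$ there is a couple $y'$ with $(s',\rho')R'y'$ and $yBy'$, and (back) for every couple $y'$ with $(s',\rho')R'y'$ there is a couple $y$ with $(s,\rho)Ry$ and $yBy'$; (F-f) for every $h'\in\rho'$ there is $h\in\rho$ such that for every $r\in h$ with $s<r$ there is $r'\in h'$ with $s'<'r'$ and $(r,[h]_{I_r})B(r',[h']_{I'_{r'}})$; (F-b) for every $h\in\rho$ there is $h'\in\rho'$ such that for every $r'\in h'$ with $s'<'r'$ there is $r\in h$ with $s<r$ and $(r,[h]_{I_r})B(r',[h']_{I'_{r'}})$. -}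

module Defs where

open import Level using (Level; 0ℓ; Lift; lift) renaming (suc to lsuc)
open import Data.Nat using (ℕ)
open import Data.Product using (Σ; _×_; _,_; proj₁; proj₂)
open import Data.Sum using (_⊎_)
open import Relation.Nullary using (¬_)
open import Relation.Binary.PropositionalEquality using (_≡_)
open import Relation.Unary using (Pred; _∈_; _⊆_)

Subset : Set → Set₁
Subset T = Pred T 0ℓ

module _ {T : Set} (_<_ : T → T → Set) where

  Linear : Subset T → Set
  Linear h = ∀ a b → a ∈ h → b ∈ h → (a < b) ⊎ (a ≡ b) ⊎ (b < a)

  IsHistory : Subset T → Set₁
  IsHistory h = Linear h × (∀ (k : Subset T) → Linear k → h ⊆ k → k ⊆ h)

  InH : T → Subset T → Set₁
  InH t h = IsHistory h × (t ∈ h)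

record IsTree (T : Set) (_<_ : T → T → Set) : Set where
  field
    irrefl : ∀ a → ¬ (a < a)
    trans  : ∀ a b c → a < b → b < c → a < c
    downLinear : ∀ a b c → b < a → c < a → (b ≡ c) ⊎ (b < c) ⊎ (c < b)

-- Models.  An I_t-class π is represented by any history h ∈ H_t with
-- π = [h]_{I_t}; a couple (t,π) is represented by (t,h).

record Model : Set₁ where
  field
    T     : Set
    _<_   : T → T → Set
    tree  : IsTree T _<_
    -- I t h k : "h I_t k", meaningful for h, k ∈ H_t
    I     : T → Subset T → Subset T → Set
    I-refl  : ∀ t h → InH _<_ t h → I t h h
    I-sym   : ∀ t h k → InH _<_ t h → InH _<_ t k → I t h k → I t k h
    I-trans : ∀ t h k l → InH _<_ t h → InH _<_ t k → InH _<_ t l →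
              I t h k → I t k l → I t h l
    -- histories are sets: extensionally equal histories are the same
    I-ext   : ∀ t h k → InH _<_ t h → InH _<_ t k →
              (∀ x → (x ∈ h → x ∈ k) × (x ∈ k → x ∈ h)) → I t h k
    I-mono  : ∀ t s h k → InH _<_ t h → InH _<_ t k → s < t → I t h k → I s h k
    -- V p t h : "(t,[h]_{I_t}) ∈ V(p)"; it depends only on the class
    V     : ℕ → T → Subset T → Set
    V-inv : ∀ p t h k → InH _<_ t h → InH _<_ t k → I t h k → V p t h → V p t k

record Couple (M : Model) : Set₁ where
  constructor couple
  open Model M
  field
    pt   : T
    hist : Subset T
    inH  : InH _<_ pt hist

module _ (M : Model) where
  open Model M
  open Couple

  InClass : T → Subset T → Subset T → Set₁
  InClass t h k = InH _<_ t k × Lift (lsuc 0ℓ) (I t h k)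

  _≺_ : Couple M → Couple M → Set₁
  x ≺ y = Lift (lsuc 0ℓ) (pt x < pt y) ×
          (∀ k → InClass (pt y) (hist y) k → InClass (pt x) (hist x) k)

  _≻_ : Couple M → Couple M → Set₁
  x ≻ y = y ≺ x

  _∼_ : Couple M → Couple M → Set₁
  x ∼ y = Lift (lsuc 0ℓ) (pt x ≡ pt y)

data Formula : Set where
  var  : ℕ → Formula
  ¬'_  : Formula → Formula
  _∧'_ : Formula → Formula → Formula
  G    : Formula → Formula
  H    : Formula → Formula
  L    : Formula → Formula
  F    : Formula → Formula

module _ (M : Model) where
  open Model M

  Sat : Formula → T → Subset T → Set₁
  Sat (var p)  t h = Lift (lsuc 0ℓ) (V p t h)
  Sat (¬' φ)   t h = ¬ Sat φ t h
  Sat (φ ∧' ψ) t h = Sat φ t h × Sat ψ t h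
  Sat (G φ)    t h = ∀ k → InClass M t h k → ∀ s → s ∈ k → t < s → Sat φ s k
  Sat (H φ)    t h = ∀ k → InClass M t h k → ∀ s → s ∈ k → s < t → Sat φ s k
  Sat (L φ)    t h = ∀ k → InH _<_ t k → Sat φ t k
  Sat (F φ)    t h = ∀ k → InClass M t h k →
                     Σ T λ s → (s ∈ k) × (t < s) × Sat φ s k

_⊨_ : {M : Model} → Couple M → Formula → Set₁
_⊨_ {M} x φ = Sat M φ (Couple.pt x) (Couple.hist x)

record IsBisimulation (M M' : Model) (B : Couple M → Couple M' → Set₁) : Set₂ where
  module 𝓜 = Model M
  module 𝓜' = Model M'
  open Couple
  field
    pv : ∀ x x' → B x x' → ∀ p →
         (𝓜.V p (pt x) (hist x) → 𝓜'.V p (pt x') (hist x')) ×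
         (𝓜'.V p (pt x') (hist x') → 𝓜.V p (pt x) (hist x))
    forth-≺ : ∀ x x' → B x x' → ∀ y → _≺_ M x y → Σ (Couple M') λ y' → _≺_ M' x' y' × B y y'
    back-≺  : ∀ x x' → B x x' → ∀ y' → _≺_ M' x' y' → Σ (Couple M) λ y → _≺_ M x y × B y y'
    forth-≻ : ∀ x x' → B x x' → ∀ y → _≻_ M x y → Σ (Couple M') λ y' → _≻_ M' x' y' × B y y'
    back-≻  : ∀ x x' → B x x' → ∀ y' → _≻_ M' x' y' → Σ (Couple M) λ y → _≻_ M x y × B y y'
    forth-∼ : ∀ x x' → B x x' → ∀ y → _∼_ M x y → Σ (Couple M') λ y' → _∼_ M' x' y' × B y y'
    back-∼  : ∀ x x' → B x x' → ∀ y' → _∼_ M' x' y' → Σ (Couple M) λ y → _∼_ M x y × B y y'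
    F-f : ∀ x x' → B x x' → ∀ k' → (ik' : InClass M' (pt x') (hist x') k') →
          Σ (Subset 𝓜.T) λ k → Σ (InClass M (pt x) (hist x) k) λ ik →
            ∀ r → (r∈k : r ∈ k) → 𝓜._<_ (pt x) r →
              Σ 𝓜'.T λ r' → Σ (r' ∈ k') λ r'∈k' → 𝓜'._<_ (pt x') r' ×
                B (couple r k (proj₁ (proj₁ ik) , r∈k))
                  (couple r' k' (proj₁ (proj₁ ik') , r'∈k'))
    F-b : ∀ x x' → B x x' → ∀ k → (ik : InClass M (pt x) (hist x) k) →
          Σ (Subset 𝓜'.T) λ k' → Σ (InClass M' (pt x') (hist x') k') λ ik' →
            ∀ r' → (r'∈k' : r' ∈ k') → 𝓜'._<_ (pt x') r' →
              Σ 𝓜.T λ r → Σ (r ∈ k) λ r∈k → 𝓜._<_ (pt x) r ×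
                B (couple r k (proj₁ (proj₁ ik) , r∈k))
                  (couple r' k' (proj₁ (proj₁ ik') , r'∈k'))

-- Induction on φ, proving preservation along every bisimulation at once so that
-- the ¬ case can use the converse bisimulation. G, H and L reduce to the
-- back clauses for ≺, ≻ and ∼: a history k' through a later (earlier) point s'
-- of the class of h' yields a couple (s',[k']) above (below) (t',[h']), and
-- truth at a ≺-neighbour only needs that histories are downward closed and
-- that satisfaction depends on the I-class alone. F is exactly clause (F-f).
module Submission where

open import Defs
open import Data.Product using (_×_; _,_; proj₁; proj₂)
open import Data.Sum using (_⊎_; inj₁; inj₂)
open import Level using (lift)
open import Relation.Binary.PropositionalEquality using (_≡_; refl)
open import Relation.Unary using (_∈_)

module _ {T : Set} {_<_ : T → T → Set} (tree : IsTree T _<_) where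
  open IsTree tree

  comparable-below : ∀ {j : Subset T} {a s t} → Linear _<_ j → a ∈ j → s ∈ j → t < s →
                     (a < t) ⊎ (a ≡ t) ⊎ (t < a)
  comparable-below {a = a} {s} {t} lin a∈j s∈j t<s with lin a s a∈j s∈j
  ... | inj₂ (inj₁ refl) = inj₂ (inj₂ t<s)
  ... | inj₂ (inj₂ s<a)  = inj₂ (inj₂ (trans t s a t<s s<a))
  ... | inj₁ a<s with downLinear s a t a<s t<s
  ...   | inj₁ a≡t        = inj₂ (inj₁ a≡t)
  ...   | inj₂ (inj₁ a<t) = inj₁ a<t
  ...   | inj₂ (inj₂ t<a) = inj₂ (inj₂ t<a)

  Linear-insert-below : ∀ {j : Subset T} {s t} → Linear _<_ j → s ∈ j → t < s →
                        Linear _<_ (λ z → z ∈ j ⊎ z ≡ t)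
  Linear-insert-below lin s∈j t<s a b (inj₁ a∈j) (inj₁ b∈j) = lin a b a∈j b∈j
  Linear-insert-below lin s∈j t<s a _ (inj₁ a∈j) (inj₂ refl) = comparable-below lin a∈j s∈j t<s
  Linear-insert-below lin s∈j t<s _ b (inj₂ refl) (inj₁ b∈j)
    with comparable-below lin b∈j s∈j t<s
  ... | inj₁ b<t         = inj₂ (inj₂ b<t)
  ... | inj₂ (inj₁ refl) = inj₂ (inj₁ refl)
  ... | inj₂ (inj₂ t<b)  = inj₁ t<b
  Linear-insert-below lin s∈j t<s _ _ (inj₂ refl) (inj₂ refl) = inj₂ (inj₁ refl)

  History-downClosed : ∀ {j : Subset T} {s t} → IsHistory _<_ j → s ∈ j → t < s → t ∈ j
  History-downClosed {j} {t = t} (lin , maximal) s∈j t<s =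
    maximal (λ z → z ∈ j ⊎ z ≡ t) (Linear-insert-below lin s∈j t<s) inj₁ (inj₂ refl)

module _ (M : Model) where
  open Model M
  open Couple

  Sat-resp-I : ∀ φ {t h k} → InH _<_ t h → InH _<_ t k → I t h k →
               Sat M φ t h → Sat M φ t k
  Sat-resp-I (var p)  ih ik hIk (lift v) = lift (V-inv p _ _ _ ih ik hIk v)
  Sat-resp-I (¬' φ)   ih ik hIk ¬φ φk = ¬φ (Sat-resp-I φ ik ih (I-sym _ _ _ ih ik hIk) φk)
  Sat-resp-I (φ ∧' ψ) ih ik hIk (φh , ψh) = Sat-resp-I φ ih ik hIk φh , Sat-resp-I ψ ih ik hIk ψh
  Sat-resp-I (G φ)    ih ik hIk Gφ j (ij , lift kIj) = Gφ j (ij , lift (I-trans _ _ _ _ ih ik ij hIk kIj))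
  Sat-resp-I (H φ)    ih ik hIk Hφ j (ij , lift kIj) = Hφ j (ij , lift (I-trans _ _ _ _ ih ik ij hIk kIj))
  Sat-resp-I (L φ)    ih ik hIk Lφ = Lφ
  Sat-resp-I (F φ)    ih ik hIk Fφ j (ij , lift kIj) = Fφ j (ij , lift (I-trans _ _ _ _ ih ik ij hIk kIj))

  InClass-refl : ∀ (x : Couple M) → InClass M (pt x) (hist x) (hist x)
  InClass-refl x = inH x , lift (I-refl _ _ (inH x))

  couple-in-class : ∀ (x : Couple M) {k s} → InClass M (pt x) (hist x) k → s ∈ k → Couple M
  couple-in-class x {k} {s} ((isHist , _) , _) s∈k = couple s k (isHist , s∈k)

  ≺-later : ∀ (x : Couple M) {k s} (ik : InClass M (pt x) (hist x) k) (s∈k : s ∈ k) →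
            pt x < s → _≺_ M x (couple-in-class x ik s∈k)
  ≺-later x {k} (ik , lift hIk) s∈k t<s = lift t<s , λ where
    j ((isHist , s∈j) , lift kIj) →
      let ij = isHist , History-downClosed tree isHist s∈j t<s
      in ij , lift (I-trans _ _ _ _ (inH x) ik ij hIk
                     (I-mono _ _ _ _ (proj₁ ik , s∈k) (isHist , s∈j) t<s kIj))

  ≺-earlier : ∀ (x : Couple M) {k s} (ik : InClass M (pt x) (hist x) k) (s∈k : s ∈ k) →
              s < pt x → _≺_ M (couple-in-class x ik s∈k) x
  ≺-earlier x {k} (ik , lift hIk) s∈k s<t = lift s<t , λ where
    j (ij , lift hIj) →
      (proj₁ ij , History-downClosed tree (proj₁ ij) (proj₂ ij) s<t) ,
      lift (I-mono _ _ _ _ ik ij s<t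
              (I-trans _ _ _ _ ik (inH x) ij (I-sym _ _ _ (inH x) ik hIk) hIj))

  G-≺ : ∀ φ (x y : Couple M) → x ⊨ G φ → _≺_ M x y → y ⊨ φ
  G-≺ φ x y Gφ (lift x<y , x⊇y) = Gφ (hist y) (x⊇y _ (InClass-refl y)) _ (proj₂ (inH y)) x<y

  H-≺ : ∀ φ (x y : Couple M) → x ⊨ H φ → _≺_ M y x → y ⊨ φ
  H-≺ φ x y Hφ (lift y<x , y⊇x) with y⊇x (hist x) (InClass-refl x)
  ... | ix , lift yIx =
    Sat-resp-I φ ix (inH y) (I-sym _ _ _ (inH y) ix yIx)
      (Hφ (hist x) (InClass-refl x) _ (proj₂ ix) y<x)

IsBisimulation-flip : ∀ {M M' B} → IsBisimulation M M' B →
                      IsBisimulation M' M (λ x' x → B x x')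
IsBisimulation-flip bis = record
  { pv      = λ x' x b p → proj₂ (pv x x' b p) , proj₁ (pv x x' b p)
  ; forth-≺ = λ x' x → back-≺ x x'
  ; back-≺  = λ x' x → forth-≺ x x'
  ; forth-≻ = λ x' x → back-≻ x x'
  ; back-≻  = λ x' x → forth-≻ x x'
  ; forth-∼ = λ x' x → back-∼ x x'
  ; back-∼  = λ x' x → forth-∼ x x'
  ; F-f     = λ x' x → F-b x x'
  ; F-b     = λ x' x → F-f x x'
  }
  where open IsBisimulation bis

⊨-preserved : ∀ φ {M M' B} → IsBisimulation M M' B →
              ∀ (x : Couple M) (x' : Couple M') → B x x' → x ⊨ φ → x' ⊨ φ
⊨-preserved (var p) bis x x' b (lift v) = lift (proj₁ (IsBisimulation.pv bis x x' b p) v)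
⊨-preserved (¬' φ) bis x x' b ¬φ φ' = ¬φ (⊨-preserved φ (IsBisimulation-flip bis) x' x b φ')
⊨-preserved (φ ∧' ψ) bis x x' b (φx , ψx) = ⊨-preserved φ bis x x' b φx , ⊨-preserved ψ bis x x' b ψx
⊨-preserved (G φ) {M} {M'} bis x x' b Gφ k' ik' s' s'∈k' t'<s'
  with IsBisimulation.back-≺ bis x x' b y' (≺-later M' x' ik' s'∈k' t'<s')
  where y' = couple-in-class M' x' ik' s'∈k'
... | y , x≺y , yBy' = ⊨-preserved φ bis y _ yBy' (G-≺ M φ x y Gφ x≺y)
⊨-preserved (H φ) {M} {M'} bis x x' b Hφ k' ik' s' s'∈k' s'<t'
  with IsBisimulation.back-≻ bis x x' b y' (≺-earlier M' x' ik' s'∈k' s'<t')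
  where y' = couple-in-class M' x' ik' s'∈k'
... | y , y≺x , yBy' = ⊨-preserved φ bis y _ yBy' (H-≺ M φ x y Hφ y≺x)
⊨-preserved (L φ) bis x x' b Lφ k' ik'
  with IsBisimulation.back-∼ bis x x' b (couple _ k' ik') (lift refl)
... | couple _ k ik , lift refl , yBy' = ⊨-preserved φ bis _ _ yBy' (Lφ k ik)
⊨-preserved (F φ) bis x x' b Fφ k' ik' with IsBisimulation.F-f bis x x' b k' ik'
... | k , ik , match with Fφ k ik
... | s , s∈k , t<s , φs with match s s∈k t<s
... | s' , s'∈k' , t'<s' , sBs' = s' , s'∈k' , t'<s' , ⊨-preserved φ bis _ _ sBs' φs

mainTheorem7 : (M M' : Model) (x : Couple M) (x' : Couple M')
    (B : Couple M → Couple M' → Set₁) → IsBisimulation M M' B → B x x' →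
    (φ : Formula) → ((x ⊨ φ) → (x' ⊨ φ)) × ((x' ⊨ φ) → (x ⊨ φ))
mainTheorem7 M M' x x' B bis b φ =
  ⊨-preserved φ bis x x' b , ⊨-preserved φ (IsBisimulation-flip bis) x' x b
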